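{- For non-negative integers $a,b,c$ define $$U(a,b,c):=a\binom{a+b}{a}\sum_{j=0}^{c-1}\binom{a+j}{a}\binom{b+j}{b-1}.$$ Then $U$ is symmetric: for every permutation $(a',b',c')$ of $(a,b,c)$ we have $U(a',b',c')=U(a,b,c)$.
   Context: Convention: an empty sum equals $0$, and $\binom{N}{k}=0$ whenever $k<0$ or $k>N$. -}

module Defs where

open import Data.Nat using (ℕ; zero; suc; _+_; _*_)
open import Data.Nat.Combinatorics using (_C_)

sumBelow : ℕ → (ℕ → ℕ) → ℕ
sumBelow zero    f = 0
sumBelow (suc c) f = sumBelow c f + f c

-- binom n (k - 1) with the convention binom n (-1) = 0
choosePred : ℕ → ℕ → ℕ
choosePred n zero    = 0
choosePred n (suc k) = n C k

U : ℕ → ℕ → ℕ → ℕ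
U a b c = a * ((a + b) C a) * sumBelow c (λ j → ((a + j) C a) * choosePred (b + j) b)

module Submission where

-- The symmetric group on
-- three letters is generated by the transpositions a↔b and b↔c, so it
-- suffices to prove these two symmetries.
--
-- * a↔b holds summand by summand: by absorption (j+1)·C(b+j,b-1) = b·C(b+j,b),
--   so (j+1) times the j-th summand is a·b·C(a+b,a)·C(a+j,a)·C(b+j,b),
--   visibly symmetric in a and b; cancel the factor j+1.
-- * b↔c is a telescoping argument.  Writing T b j for the j-th summand of
--   U(a,b,·), the exchange identity T b c + T (c+1) b = T c b + T (b+1) c
--   together with T 0 j = 0 implies Σ_{j<c} T b j = Σ_{j<b} T c j for any
--   such doubly indexed family (lemma sumBelow-transpose).  The exchange
--   identity itself reduces, after multiplying by (b+1)(c+1) and absorbing,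
--   to a polynomial identity.

open import Defs
open import Data.Nat using (ℕ; zero; suc; _+_; _*_)
open import Data.Nat.Properties
  using (+-comm; +-assoc; +-suc; *-zeroʳ; *-identityˡ; *-identityʳ; *-comm;
         *-distribˡ-+; *-cancelˡ-≡; m≤m+n; m+n∸m≡n)
open import Data.Nat.Combinatorics
  using (_C_; nC1≡n; nCk+nC[k+1]≡[n+1]C[k+1]; nCk≡nC[n∸k])
open import Data.Nat.Tactic.RingSolver using (solve-∀)
open import Data.Product using (_×_; _,_)
open import Relation.Binary.PropositionalEquality
  using (_≡_; refl; sym; trans; cong; cong₂; module ≡-Reasoning)

open ≡-Reasoning

absorption : ∀ n k → suc k * (suc n C suc k) ≡ suc n * (n C k)
absorption zero    zero    = refl
absorption zero    (suc k) = *-zeroʳ (suc (suc k))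
absorption (suc n) zero    = begin
  1 * (suc (suc n) C 1) ≡⟨ *-identityˡ _ ⟩
  suc (suc n) C 1       ≡⟨ nC1≡n (suc (suc n)) ⟩
  suc (suc n)           ≡⟨ sym (*-identityʳ _) ⟩
  suc (suc n) * 1       ∎
absorption (suc n) (suc k) = begin
  suc (suc k) * (suc (suc n) C suc (suc k))
    ≡⟨ cong (suc (suc k) *_) (sym (nCk+nC[k+1]≡[n+1]C[k+1] (suc n) (suc k))) ⟩
  suc (suc k) * (X + Z)                  ≡⟨ *-distribˡ-+ (suc (suc k)) X Z ⟩
  X + suc k * X + suc (suc k) * Z
    ≡⟨ cong₂ (λ u v → X + u + v) (absorption n k) (absorption n (suc k)) ⟩
  X + suc n * x + suc n * y              ≡⟨ cong (λ w → w + suc n * x + suc n * y) (sym pascal) ⟩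
  x + y + suc n * x + suc n * y          ≡⟨ regroup x y n ⟩
  suc (suc n) * (x + y)                  ≡⟨ cong (suc (suc n) *_) pascal ⟩
  suc (suc n) * X                        ∎
  where
  X = suc n C suc k
  Z = suc n C suc (suc k)
  x = n C k
  y = n C suc k
  pascal : x + y ≡ X
  pascal = nCk+nC[k+1]≡[n+1]C[k+1] n k
  regroup : ∀ x y n → x + y + suc n * x + suc n * y ≡ suc (suc n) * (x + y)
  regroup = solve-∀

binom-symm : ∀ k j → (k + j) C k ≡ (k + j) C j
binom-symm k j = trans (nCk≡nC[n∸k] (m≤m+n k j)) (cong ((k + j) C_) (m+n∸m≡n k j))

binom-swap : ∀ a b → (a + b) C a ≡ (b + a) C b
binom-swap a b = trans (binom-symm a b) (cong (_C b) (+-comm a b))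

upper-absorption : ∀ k j → suc j * (suc (k + j) C k) ≡ suc (k + j) * ((k + j) C k)
upper-absorption k j = begin
  suc j * (suc (k + j) C k)     ≡⟨ cong (λ n → suc j * (n C k)) (sym (+-suc k j)) ⟩
  suc j * ((k + suc j) C k)     ≡⟨ cong (suc j *_) (binom-symm k (suc j)) ⟩
  suc j * ((k + suc j) C suc j) ≡⟨ cong (λ n → suc j * (n C suc j)) (+-suc k j) ⟩
  suc j * (suc (k + j) C suc j) ≡⟨ absorption (k + j) j ⟩
  suc (k + j) * ((k + j) C j)   ≡⟨ cong (suc (k + j) *_) (sym (binom-symm k j)) ⟩
  suc (k + j) * ((k + j) C k)   ∎

choosePred-absorption : ∀ k j → suc j * choosePred (k + j) k ≡ k * ((k + j) C k)
choosePred-absorption zero    j = *-zeroʳ (suc j)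
choosePred-absorption (suc k) j = trans (upper-absorption k j) (sym (absorption (k + j) k))

sumBelow-cong : ∀ c {f g : ℕ → ℕ} → (∀ j → f j ≡ g j) → sumBelow c f ≡ sumBelow c g
sumBelow-cong zero    f≡g = refl
sumBelow-cong (suc c) f≡g = cong₂ _+_ (sumBelow-cong c f≡g) (f≡g c)

sumBelow-*ˡ : ∀ x c f → x * sumBelow c f ≡ sumBelow c (λ j → x * f j)
sumBelow-*ˡ x zero    f = *-zeroʳ x
sumBelow-*ˡ x (suc c) f =
  trans (*-distribˡ-+ x (sumBelow c f) (f c)) (cong (_+ x * f c) (sumBelow-*ˡ x c f))

sumBelow-zero : ∀ c {f : ℕ → ℕ} → (∀ j → f j ≡ 0) → sumBelow c f ≡ 0
sumBelow-zero zero    f≡0 = refl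
sumBelow-zero (suc c) f≡0 = cong₂ _+_ (sumBelow-zero c f≡0) (f≡0 c)

module Transpose (T : ℕ → ℕ → ℕ)
  (T-zero : ∀ j → T 0 j ≡ 0)
  (exchange : ∀ b c → T b c + T (suc c) b ≡ T c b + T (suc b) c) where

  shift : ∀ b c → sumBelow b (T (suc c)) ≡ sumBelow b (T c) + T b c
  shift zero    c = sym (T-zero c)
  shift (suc b) c = begin
    sumBelow b (T (suc c)) + T (suc c) b    ≡⟨ cong (_+ T (suc c) b) (shift b c) ⟩
    S + T b c + T (suc c) b                 ≡⟨ +-assoc S _ _ ⟩
    S + (T b c + T (suc c) b)               ≡⟨ cong (S +_) (exchange b c) ⟩
    S + (T c b + T (suc b) c)               ≡⟨ sym (+-assoc S _ _) ⟩
    S + T c b + T (suc b) c                 ∎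
    where S = sumBelow b (T c)

  sumBelow-transpose : ∀ b c → sumBelow c (T b) ≡ sumBelow b (T c)
  sumBelow-transpose b zero    = sym (sumBelow-zero b T-zero)
  sumBelow-transpose b (suc c) =
    trans (cong (_+ T b c) (sumBelow-transpose b c)) (sym (shift b c))

term : ℕ → ℕ → ℕ → ℕ
term a b j = a * ((a + b) C a) * (((a + j) C a) * choosePred (b + j) b)

U-as-sum : ∀ a b c → U a b c ≡ sumBelow c (term a b)
U-as-sum a b c = sumBelow-*ˡ (a * ((a + b) C a)) c _

term-scaled : ∀ a b j →
  suc j * term a b j ≡ a * b * ((a + b) C a) * (((a + j) C a) * ((b + j) C b))
term-scaled a b j = begin
  suc j * (a * A * (P * p)) ≡⟨ pull a A P p (suc j) ⟩
  a * A * P * (suc j * p)   ≡⟨ cong (a * A * P *_) (choosePred-absorption b j) ⟩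
  a * A * P * (b * Q)       ≡⟨ push a b A P Q ⟩
  a * b * A * (P * Q)       ∎
  where
  A = (a + b) C a
  P = (a + j) C a
  Q = (b + j) C b
  p = choosePred (b + j) b
  pull : ∀ a A P p s → s * (a * A * (P * p)) ≡ a * A * P * (s * p)
  pull = solve-∀
  push : ∀ a b A P Q → a * A * P * (b * Q) ≡ a * b * A * (P * Q)
  push = solve-∀

term-swap : ∀ a b j → term a b j ≡ term b a j
term-swap a b j = *-cancelˡ-≡ (term a b j) (term b a j) (suc j) (begin
  suc j * term a b j              ≡⟨ term-scaled a b j ⟩
  a * b * ((a + b) C a) * (P * Q) ≡⟨ cong₂ (λ m X → m * X * (P * Q)) (*-comm a b) (binom-swap a b) ⟩
  b * a * ((b + a) C b) * (P * Q) ≡⟨ cong (b * a * ((b + a) C b) *_) (*-comm P Q) ⟩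
  b * a * ((b + a) C b) * (Q * P) ≡⟨ sym (term-scaled b a j) ⟩
  suc j * term b a j              ∎)
  where
  P = (a + j) C a
  Q = (b + j) C b

U-swap₁₂ : ∀ a b c → U a b c ≡ U b a c
U-swap₁₂ a b c = begin
  U a b c                ≡⟨ U-as-sum a b c ⟩
  sumBelow c (term a b)  ≡⟨ sumBelow-cong c (term-swap a b) ⟩
  sumBelow c (term b a)  ≡⟨ sym (U-as-sum b a c) ⟩
  U b a c                ∎

weight : ℕ → ℕ → ℕ → ℕ
weight a b c = a * ((a + b) C a) * ((a + c) C a) * ((b + c) C b)

weight-swap : ∀ a b c → weight a b c ≡ weight a c b
weight-swap a b c = begin
  a * A * B * ((b + c) C b) ≡⟨ cong (a * A * B *_) (binom-swap b c) ⟩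
  a * A * B * ((c + b) C c) ≡⟨ cong (λ m → m * ((c + b) C c)) (reorder a A B) ⟩
  a * B * A * ((c + b) C c) ∎
  where
  A = (a + b) C a
  B = (a + c) C a
  reorder : ∀ a A B → a * A * B ≡ a * B * A
  reorder = solve-∀

exchange-scaled : ∀ a b c →
  suc b * suc c * (term a b c + term a (suc c) b)
    ≡ weight a b c * (b * suc b + suc (a + c) * suc (b + c))
exchange-scaled a b c = begin
  suc b * suc c * (a * A * (B * p) + a * q * (A * r))
    ≡⟨ expand a b c A B p q r ⟩
  a * A * B * (suc b * (suc c * p)) + a * A * ((suc c * q) * (suc b * r))
    ≡⟨ cong₂ (λ u v → a * A * B * (suc b * u) + a * A * v)
             (choosePred-absorption b c) (cong₂ _*_ absorb-q absorb-r) ⟩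
  a * A * B * (suc b * (b * Cbc)) + a * A * ((suc (a + c) * B) * (suc (b + c) * Cbc))
    ≡⟨ collect a b c A B Cbc ⟩
  weight a b c * (b * suc b + suc (a + c) * suc (b + c)) ∎
  where
  A   = (a + b) C a
  B   = (a + c) C a
  Cbc = (b + c) C b
  p   = choosePred (b + c) b
  q   = (a + suc c) C a
  r   = suc (c + b) C c
  absorb-q : suc c * q ≡ suc (a + c) * B
  absorb-q = trans (cong (λ n → suc c * (n C a)) (+-suc a c)) (upper-absorption a c)
  absorb-r : suc b * r ≡ suc (b + c) * Cbc
  absorb-r = trans (upper-absorption c b)
                   (cong₂ (λ n X → suc n * X) (+-comm c b) (binom-swap c b))
  expand : ∀ a b c A B p q r →
    suc b * suc c * (a * A * (B * p) + a * q * (A * r))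
      ≡ a * A * B * (suc b * (suc c * p)) + a * A * ((suc c * q) * (suc b * r))
  expand = solve-∀
  collect : ∀ a b c A B X →
    a * A * B * (suc b * (b * X)) + a * A * ((suc (a + c) * B) * (suc (b + c) * X))
      ≡ a * A * B * X * (b * suc b + suc (a + c) * suc (b + c))
  collect = solve-∀

exchange-polynomial : ∀ a b c →
  b * suc b + suc (a + c) * suc (b + c) ≡ c * suc c + suc (a + b) * suc (c + b)
exchange-polynomial = solve-∀

exchange : ∀ a b c → term a b c + term a (suc c) b ≡ term a c b + term a (suc b) c
exchange a b c = *-cancelˡ-≡ _ _ (suc b * suc c) (begin
  suc b * suc c * (term a b c + term a (suc c) b)         ≡⟨ exchange-scaled a b c ⟩
  weight a b c * (b * suc b + suc (a + c) * suc (b + c))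
    ≡⟨ cong₂ _*_ (weight-swap a b c) (exchange-polynomial a b c) ⟩
  weight a c b * (c * suc c + suc (a + b) * suc (c + b))  ≡⟨ sym (exchange-scaled a c b) ⟩
  suc c * suc b * (term a c b + term a (suc b) c)
    ≡⟨ cong (_* (term a c b + term a (suc b) c)) (*-comm (suc c) (suc b)) ⟩
  suc b * suc c * (term a c b + term a (suc b) c)         ∎)

-- For b = 0 every summand vanishes, since C(j,-1) = 0.
term-zero : ∀ a j → term a 0 j ≡ 0
term-zero a j =
  trans (cong (a * ((a + 0) C a) *_) (*-zeroʳ ((a + j) C a))) (*-zeroʳ (a * ((a + 0) C a)))

U-swap₂₃ : ∀ a b c → U a b c ≡ U a c b
U-swap₂₃ a b c = begin
  U a b c               ≡⟨ U-as-sum a b c ⟩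
  sumBelow c (term a b) ≡⟨ sumBelow-transpose b c ⟩
  sumBelow b (term a c) ≡⟨ sym (U-as-sum a c b) ⟩
  U a c b               ∎
  where open Transpose (term a) (term-zero a) (exchange a)

corollary2p3 : (a b c : ℕ) →
    (U a c b ≡ U a b c) × (U b a c ≡ U a b c) × (U b c a ≡ U a b c) ×
    (U c a b ≡ U a b c) × (U c b a ≡ U a b c)
corollary2p3 a b c =
    sym (U-swap₂₃ a b c)
  , sym (U-swap₁₂ a b c)
  , trans (U-swap₂₃ b c a) (U-swap₁₂ b a c)
  , cab
  , trans (U-swap₂₃ c b a) cab
  where
  cab : U c a b ≡ U a b c
  cab = trans (U-swap₁₂ c a b) (U-swap₂₃ a c b)
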